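{- Over the universe $[n]$, the family $\mathcal F=\{[1],[2],[3],\dots,[n]\}$, where $[i]=\{1,\dots,i\}$, is $(n-1)$-dense.
   Context: A family $\mathcal F$ of subsets of $[n]$ is union-closed over the universe $[n]$ if $[n]\in\mathcal F$ and $A\cup B\in\mathcal F$ for all $A,B\in\mathcal F$. Convention: the empty set is never a member of any family considered; $2^{[n]}$ denotes the family of all nonempty subsets of $[n]$. The closure of a union-closed $\mathcal F$ is $\overline{\mathcal F}=\{A\in 2^{[n]}:\ \mathcal F\cup\{A\}\text{ is union-closed}\}$; iterated closures are $\overline{\mathcal F}^{(0)}=\mathcal F$, $\overline{\mathcal F}^{(i)}=\overline{\overline{\mathcal F}^{(i-1)}}$. $\mathcal F$ is $k$-dense if $k$ is the smallest nonnegative integer with $\overline{\mathcal F}^{(k)}=2^{[n]}$. -}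

module Defs where

open import Data.Nat using (ℕ; zero; suc; _≤_; _<_; _<ᵇ_)
open import Data.Fin using (Fin; toℕ)
open import Data.Fin.Subset using (Subset; ⊤; _∪_; Nonempty)
open import Data.Vec using (tabulate)
open import Data.Product using (Σ; ∃; _×_)
open import Data.Sum using (_⊎_)
open import Relation.Binary.PropositionalEquality using (_≡_)
open import Relation.Nullary using (¬_)
open import Function.Bundles using (_⇔_)

Family : ℕ → Set₁
Family n = Subset n → Set

insert : ∀ {n} → Family n → Subset n → Family n
insert F A X = F X ⊎ X ≡ A

UnionClosed : ∀ {n} → Family n → Set
UnionClosed {n} F = F ⊤ × (∀ B C → F B → F C → F (B ∪ C))

-- closure: all nonempty A with F ∪ {A} union-closed
-- (the empty set is never a member of a family)
closure : ∀ {n} → Family n → Family n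
closure F A = Nonempty A × UnionClosed (insert F A)

closureIter : ∀ {n} → ℕ → Family n → Family n
closureIter zero    F = F
closureIter (suc i) F = closure (closureIter i F)

powerFamily : ∀ n → Family n
powerFamily n A = Nonempty A

_≐_ : ∀ {n} → Family n → Family n → Set
F ≐ G = ∀ A → F A ⇔ G A

IsKDense : ∀ n → ℕ → Family n → Set
IsKDense n k F =
  (closureIter k F ≐ powerFamily n) × (∀ j → j < k → ¬ (closureIter j F ≐ powerFamily n))

-- [i] = {1,…,i} ⊆ [n]; element j : Fin n stands for j+1
prefix : ∀ n → ℕ → Subset n
prefix n i = tabulate (λ (j : Fin n) → toℕ j <ᵇ i)

chainFamily : ∀ n → Family n
chainFamily n X = Σ ℕ (λ i → (1 ≤ i × i ≤ n) × X ≡ prefix n i)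

module Submission where

-- For a nonempty A ⊆ [n] let the deficiency of A be the number of elements
-- of [n] missing from A below max A, i.e. max A − |A|.  The sets of
-- deficiency 0 are exactly the prefixes [i], and we show that the j-th
-- iterated closure of the chain is the layer
--     L_j = { A nonempty : deficiency A ≤ j }.
-- The engine is a trichotomy for unions: x ∪ a is either a itself, or has
-- smaller deficiency than a (when max x ≤ max a), or deficiency at most that
-- of x (when max x > max a).  It makes every L_j union-closed and shows that
-- any A with deficiency ≤ j+1 can be added to L_j; conversely, filling the
-- first gap of A by a prefix lowers its deficiency by exactly one, so
-- closure L_j = L_{j+1}.  Since closure respects extensional equality of
-- families, closure^j of the chain is L_j.  Every set has deficiency ≤ n-1,
-- so L_{n-1} is everything, while the singleton {n} has deficiency n-1, so no
-- earlier layer is.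

open import Defs
open import Data.Nat using (ℕ; zero; suc; _≤_; _<_; _<?_; _∸_; z≤n; s≤s)
open import Data.Nat.Properties
  using (≤-trans; ≤-refl; ≤-reflexive; n≤1+n; <⇒≤; ≤-pred; n≤0⇒n≡0; <-≤-trans; ≮⇒≥; <⇒≱; m∸n≤m)
open import Data.Bool using (Bool; true; false; _∨_; if_then_else_)
open import Data.Vec using ([]; _∷_; tail)
open import Data.Fin using (zero; suc; fromℕ)
open import Data.Fin.Subset using (Subset; inside; outside; ⊤; ⊥; _∪_; ⁅_⁆; Nonempty)
open import Data.Fin.Subset.Properties using (∪-comm; ∪-idem; ∪-identityˡ; ∉⊥; x∈⁅x⁆; p⊆p∪q)
open import Data.Vec.Base using (here; there)
open import Data.Product using (Σ; _×_; _,_; proj₁; map₂)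
open import Data.Sum using (_⊎_; inj₁; inj₂; map₁)
open import Relation.Binary.PropositionalEquality using (_≡_; _≢_; refl; sym; trans; cong; subst; subst₂)
open import Relation.Nullary using (¬_; Dec; yes; no; contradiction)
open import Function.Bundles using (mk⇔; Equivalence)
import Function.Properties.Equivalence as ⇔

inhabited : ∀ {n} → Subset n → Bool
inhabited []      = false
inhabited (b ∷ p) = b ∨ inhabited p

inhabited⇒Nonempty : ∀ {n} (p : Subset n) → inhabited p ≡ true → Nonempty p
inhabited⇒Nonempty (inside ∷ p)  _ = zero , here
inhabited⇒Nonempty (outside ∷ p) h = map-suc (inhabited⇒Nonempty p h)
  where
  map-suc : Nonempty p → Nonempty (outside ∷ p)
  map-suc (x , x∈p) = suc x , there x∈p

Nonempty⇒inhabited : ∀ {n} (p : Subset n) → Nonempty p → inhabited p ≡ true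
Nonempty⇒inhabited (inside ∷ p)  _                   = refl
Nonempty⇒inhabited (outside ∷ p) (suc x , there x∈p) = Nonempty⇒inhabited p (x , x∈p)

uninhabited⇒⊥ : ∀ {n} (p : Subset n) → inhabited p ≡ false → p ≡ ⊥
uninhabited⇒⊥ []            _ = refl
uninhabited⇒⊥ (outside ∷ p) h = cong (outside ∷_) (uninhabited⇒⊥ p h)

Nonempty-∪ˡ : ∀ {n} (x y : Subset n) → Nonempty x → Nonempty (x ∪ y)
Nonempty-∪ˡ x y = map₂ (p⊆p∪q y)

inhabited-∪ˡ : ∀ {n} (x y : Subset n) → inhabited x ≡ true → inhabited (x ∪ y) ≡ true
inhabited-∪ˡ x y h = Nonempty⇒inhabited (x ∪ y) (Nonempty-∪ˡ x y (inhabited⇒Nonempty x h))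

-- deficiency A = number of elements outside A lying below max A.
deficiency : ∀ {n} → Subset n → ℕ
deficiency []            = 0
deficiency (inside ∷ p)  = deficiency p
deficiency (outside ∷ p) = if inhabited p then suc (deficiency p) else 0

deficiency-outside : ∀ {n} (p : Subset n) → inhabited p ≡ true →
                     deficiency (outside ∷ p) ≡ suc (deficiency p)
deficiency-outside p h rewrite h = refl

deficiency-outside-≤ : ∀ {n} (p : Subset n) → deficiency (outside ∷ p) ≤ suc (deficiency p)
deficiency-outside-≤ p with inhabited p
... | true  = ≤-refl
... | false = z≤n

deficiency-⊥ : ∀ n → deficiency (⊥ {n}) ≡ 0
deficiency-⊥ zero    = refl
deficiency-⊥ (suc n) = deficiency-⊥-outside n
  where
  inhabited-⊥ : ∀ m → inhabited (⊥ {m}) ≡ false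
  inhabited-⊥ zero    = refl
  inhabited-⊥ (suc m) = inhabited-⊥ m
  deficiency-⊥-outside : ∀ m → deficiency (outside ∷ ⊥ {m}) ≡ 0
  deficiency-⊥-outside m rewrite inhabited-⊥ m = refl

deficiency-⊤ : ∀ n → deficiency (⊤ {n}) ≡ 0
deficiency-⊤ zero    = refl
deficiency-⊤ (suc n) = deficiency-⊤ n

uninhabited⇒deficiency-0 : ∀ {n} (p : Subset n) → inhabited p ≡ false → deficiency p ≡ 0
uninhabited⇒deficiency-0 {n} p h = subst (λ q → deficiency q ≡ 0) (sym (uninhabited⇒⊥ p h)) (deficiency-⊥ n)

positive⇒inhabited : ∀ {n} (p : Subset n) → 0 < deficiency p → inhabited p ≡ true
positive⇒inhabited p pos with inhabited p in h
... | true  = refl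
... | false = contradiction pos (λ lt → <⇒≱ lt (≤-reflexive (uninhabited⇒deficiency-0 p h)))

deficiency-cons : ∀ {n} b (p : Subset n) → deficiency p ≤ deficiency (b ∷ p)
deficiency-cons inside  p = ≤-refl
deficiency-cons outside p with inhabited p in h
... | true  = n≤1+n _
... | false = ≤-reflexive (uninhabited⇒deficiency-0 p h)

leading-gap : ∀ {n} (p : Subset n) → deficiency p < deficiency (outside ∷ p) ⊎ deficiency p ≡ 0
leading-gap p with inhabited p in h
... | true  = inj₁ ≤-refl
... | false = inj₂ (uninhabited⇒deficiency-0 p h)

data UnionDeficiency {n} (x a : Subset n) : Set where
  absorbed   : x ∪ a ≡ a → UnionDeficiency x a
  belowRight : deficiency (x ∪ a) < deficiency a → UnionDeficiency x a
  belowLeft  : deficiency (x ∪ a) ≤ deficiency x → UnionDeficiency x a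

union-deficiency : ∀ {n} (x a : Subset n) → UnionDeficiency x a
union-deficiency [] [] = absorbed refl
union-deficiency (inside ∷ x) (inside ∷ a) with union-deficiency x a
... | absorbed e    = absorbed (cong (inside ∷_) e)
... | belowRight lt = belowRight lt
... | belowLeft le  = belowLeft le
union-deficiency (outside ∷ x) (inside ∷ a) with union-deficiency x a
... | absorbed e    = absorbed (cong (inside ∷_) e)
... | belowRight lt = belowRight lt
... | belowLeft le  = belowLeft (≤-trans le (deficiency-cons outside x))
union-deficiency (inside ∷ x) (outside ∷ a) with union-deficiency x a
... | belowRight lt = belowRight (<-≤-trans lt (deficiency-cons outside a))
... | belowLeft le  = belowLeft le
... | absorbed e with leading-gap a
...   | inj₁ lt = belowRight (subst (λ q → deficiency q < deficiency (outside ∷ a)) (sym e) lt)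
...   | inj₂ z  = belowLeft (subst (λ q → deficiency q ≤ deficiency x) (sym e) (≤-trans (≤-reflexive z) z≤n))
union-deficiency (outside ∷ x) (outside ∷ a) with inhabited x in hx
... | false = absorbed (cong (outside ∷_) (subst (λ q → q ∪ a ≡ a) (sym (uninhabited⇒⊥ x hx)) (∪-identityˡ a)))
... | true with union-deficiency x a
...   | absorbed e    = absorbed (cong (outside ∷_) e)
...   | belowRight lt = belowRight (subst₂ _<_ (sym (deficiency-outside (x ∪ a) (inhabited-∪ˡ x a hx)))
                                               (sym (deficiency-outside a (positive⇒inhabited a (<-≤-trans (s≤s z≤n) lt))))
                                               (s≤s lt))
...   | belowLeft le  = belowLeft (subst₂ _≤_ (sym (deficiency-outside (x ∪ a) (inhabited-∪ˡ x a hx)))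
                                             (sym (deficiency-outside x hx))
                                             (s≤s le))

Layer : ∀ {n} → ℕ → Family n
Layer j A = Nonempty A × deficiency A ≤ j

Layer-mono : ∀ {n j k} {A : Subset n} → j ≤ k → Layer j A → Layer k A
Layer-mono j≤k (neA , defA) = neA , ≤-trans defA j≤k

Layer-∪ : ∀ {n} j (x y : Subset n) → Layer j x → Layer j y → Layer j (x ∪ y)
Layer-∪ j x y (nex , defx) (ney , defy) = Nonempty-∪ˡ x y nex , bound (union-deficiency x y)
  where
  bound : UnionDeficiency x y → deficiency (x ∪ y) ≤ j
  bound (absorbed e)    = subst (λ q → deficiency q ≤ j) (sym e) defy
  bound (belowRight lt) = ≤-trans (<⇒≤ lt) defy
  bound (belowLeft le)  = ≤-trans le defx

Layer-∪-next : ∀ {n} j (b a : Subset n) → Layer j b → deficiency a ≤ suc j →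
               b ∪ a ≡ a ⊎ Layer j (b ∪ a)
Layer-∪-next j b a (neb , defb) defa with union-deficiency b a
... | absorbed e    = inj₁ e
... | belowRight lt = inj₂ (Nonempty-∪ˡ b a neb , ≤-pred (≤-trans lt defa))
... | belowLeft le  = inj₂ (Nonempty-∪ˡ b a neb , ≤-trans le defb)

fill-first-gap : ∀ {n} (a : Subset n) → 0 < deficiency a →
                 Σ (Subset n) λ P → Layer 0 P × P ∪ a ≢ a × deficiency a ≡ suc (deficiency (P ∪ a))
fill-first-gap (inside ∷ a) pos with fill-first-gap a pos
... | P , (_ , defP) , P∪a≢a , gap = inside ∷ P , ((zero , here) , defP) , (λ e → P∪a≢a (cong tail e)) , gap
fill-first-gap {suc n} (outside ∷ a) pos =
  inside ∷ ⊥ , ((zero , here) , ≤-reflexive (deficiency-⊥ n)) , (λ ()) , gap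
  where
  gap : deficiency (outside ∷ a) ≡ suc (deficiency (⊥ ∪ a))
  gap rewrite ∪-identityˡ a = deficiency-outside a (positive⇒inhabited (outside ∷ a) pos)

closure-Layer : ∀ {n} j → closure (Layer {suc n} j) ≐ Layer (suc j)
closure-Layer {n} j A = mk⇔ to from
  where
  -- a member of the closure with a gap: filling it must land in Layer j
  to : closure (Layer j) A → Layer (suc j) A
  to (neA , _ , closed) = neA , bound (0 <? deficiency A)
    where
    bound : Dec (0 < deficiency A) → deficiency A ≤ suc j
    bound (no ¬pos) = ≤-trans (≮⇒≥ ¬pos) z≤n
    bound (yes pos) with fill-first-gap A pos
    ... | P , P∈L₀ , P∪A≢A , gap with closed P A (inj₁ (Layer-mono z≤n P∈L₀)) (inj₂ refl)
    ...   | inj₁ (_ , defP∪A) = subst (_≤ suc j) (sym gap) (s≤s defP∪A)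
    ...   | inj₂ P∪A≡A        = contradiction P∪A≡A P∪A≢A
  from : Layer (suc j) A → closure (Layer j) A
  from (neA , defA) = neA , inj₁ ⊤∈Layer , closed
    where
    ⊤∈Layer : Layer j ⊤
    ⊤∈Layer = (zero , here) , ≤-trans (≤-reflexive (deficiency-⊤ (suc n))) z≤n
    with-A : ∀ B → Layer j B → insert (Layer j) A (B ∪ A)
    with-A B B∈L with Layer-∪-next j B A B∈L defA
    ... | inj₁ e    = inj₂ e
    ... | inj₂ B∪A∈L = inj₁ B∪A∈L
    closed : ∀ B D → insert (Layer j) A B → insert (Layer j) A D → insert (Layer j) A (B ∪ D)
    closed B  D  (inj₁ B∈L) (inj₁ D∈L) = inj₁ (Layer-∪ j B D B∈L D∈L)
    closed B  .A (inj₁ B∈L) (inj₂ refl) = with-A B B∈L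
    closed .A D  (inj₂ refl) (inj₁ D∈L) = subst (insert (Layer j) A) (∪-comm D A) (with-A D D∈L)
    closed .A .A (inj₂ refl) (inj₂ refl) = inj₂ (∪-idem A)

unionClosed-resp-≐ : ∀ {n} {F G : Family n} → F ≐ G → UnionClosed F → UnionClosed G
unionClosed-resp-≐ F≐G (F⊤ , closed) =
  Equivalence.to (F≐G ⊤) F⊤ ,
  λ B C G∋B G∋C → Equivalence.to (F≐G (B ∪ C))
                    (closed B C (Equivalence.from (F≐G B) G∋B) (Equivalence.from (F≐G C) G∋C))

insert-resp-≐ : ∀ {n} {F G : Family n} A → F ≐ G → insert F A ≐ insert G A
insert-resp-≐ A F≐G X = mk⇔ (map₁ (Equivalence.to (F≐G X))) (map₁ (Equivalence.from (F≐G X)))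

≐-sym : ∀ {n} {F G : Family n} → F ≐ G → G ≐ F
≐-sym F≐G X = ⇔.sym (F≐G X)

closure-resp-≐ : ∀ {n} {F G : Family n} → F ≐ G → closure F ≐ closure G
closure-resp-≐ F≐G A =
  mk⇔ (map₂ (unionClosed-resp-≐ (insert-resp-≐ A F≐G)))
      (map₂ (unionClosed-resp-≐ (insert-resp-≐ A (≐-sym F≐G))))

prefix-0 : ∀ n → prefix n 0 ≡ ⊥
prefix-0 zero    = refl
prefix-0 (suc n) = cong (outside ∷_) (prefix-0 n)

deficiency-prefix : ∀ n i → deficiency (prefix n i) ≡ 0
deficiency-prefix n       zero    = trans (cong deficiency (prefix-0 n)) (deficiency-⊥ n)
deficiency-prefix zero    (suc i) = refl
deficiency-prefix (suc n) (suc i) = deficiency-prefix n i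

gapless⇒prefix : ∀ {n} (p : Subset n) → deficiency p ≡ 0 → Σ ℕ λ i → i ≤ n × p ≡ prefix n i
gapless⇒prefix []           _ = 0 , z≤n , refl
gapless⇒prefix (inside ∷ p) e with gapless⇒prefix p e
... | i , i≤n , p≡[i] = suc i , s≤s i≤n , cong (inside ∷_) p≡[i]
gapless⇒prefix {suc n} (outside ∷ p) e with inhabited p in h
gapless⇒prefix {suc n} (outside ∷ p) () | true
gapless⇒prefix {suc n} (outside ∷ p) _  | false =
  0 , z≤n , cong (outside ∷_) (trans (uninhabited⇒⊥ p h) (sym (prefix-0 n)))

chain-Layer₀ : ∀ m → chainFamily (suc m) ≐ Layer 0
chain-Layer₀ m A = mk⇔ to from
  where
  to : chainFamily (suc m) A → Layer 0 A
  to (suc i , _ , refl) = (zero , here) , ≤-reflexive (deficiency-prefix (suc m) (suc i))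
  from : Layer 0 A → chainFamily (suc m) A
  from (neA , defA) with gapless⇒prefix A (n≤0⇒n≡0 defA)
  ... | zero  , _   , A≡[0] = contradiction (subst Nonempty (trans A≡[0] (prefix-0 (suc m))) neA)
                                            (λ (_ , x∈⊥) → ∉⊥ x∈⊥)
  ... | suc i , i≤n , A≡[i] = suc i , (s≤s z≤n , i≤n) , A≡[i]

closureIter-chain : ∀ m j → closureIter j (chainFamily (suc m)) ≐ Layer j
closureIter-chain m zero    = chain-Layer₀ m
closureIter-chain m (suc j) A = ⇔.trans (closure-resp-≐ (closureIter-chain m j) A) (closure-Layer j A)

deficiency-bound : ∀ {n} (p : Subset n) → deficiency p ≤ n ∸ 1
deficiency-bound []                = z≤n
deficiency-bound (inside ∷ p)      = ≤-trans (deficiency-bound p) (m∸n≤m _ 1)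
deficiency-bound (outside ∷ [])    = z≤n
deficiency-bound (outside ∷ b ∷ p) = ≤-trans (deficiency-outside-≤ (b ∷ p)) (s≤s (deficiency-bound (b ∷ p)))

Layer-top : ∀ m → Layer m ≐ powerFamily (suc m)
Layer-top m A = mk⇔ proj₁ (λ neA → neA , deficiency-bound A)

deficiency-last : ∀ m → deficiency ⁅ fromℕ m ⁆ ≡ m
deficiency-last zero    = deficiency-⊥ 0
deficiency-last (suc m) =
  trans (deficiency-outside ⁅ fromℕ m ⁆ (Nonempty⇒inhabited ⁅ fromℕ m ⁆ (fromℕ m , x∈⁅x⁆ (fromℕ m))))
        (cong suc (deficiency-last m))

last∉Layer : ∀ m j → j < m → ¬ Layer j ⁅ fromℕ m ⁆
last∉Layer m j j<m (_ , def≤j) = <⇒≱ j<m (subst (_≤ j) (deficiency-last m) def≤j)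

proposition1 : ∀ (n : ℕ) → 1 ≤ n → IsKDense n (n ∸ 1) (chainFamily n)
proposition1 (suc m) _ = full , minimal
  where
  full : closureIter m (chainFamily (suc m)) ≐ powerFamily (suc m)
  full A = ⇔.trans (closureIter-chain m m A) (Layer-top m A)
  minimal : ∀ j → j < m → ¬ (closureIter j (chainFamily (suc m)) ≐ powerFamily (suc m))
  minimal j j<m same = last∉Layer m j j<m
    (Equivalence.to (closureIter-chain m j last) (Equivalence.from (same last) (fromℕ m , x∈⁅x⁆ (fromℕ m))))
    where
    last : Subset (suc m)
    last = ⁅ fromℕ m ⁆
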